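{- Let $0\le a,b,c,h\le n$ with $a+b+c=n$. If $c>n-h$ and $a\ne0$, then $D_{n,h}(a,b,c)=0$.
   Context: $q$ is a power of an odd prime. Put $P(k)=\prod_{l=1}^{k}(1-(-q)^{ -l})$ (empty products $=1$, empty sums $=0$). For nonnegative integers $a,b,c$ and integer $j$: if $a+b>0$, $\mathcal C_j(a,b,c)=(-1)^{j+1}\prod_{i=1}^{a+b-1}(1-(-q)^i)$; and $\mathcal C_j(0,0,c)=\sum_{l=1}^{c}\frac1{(-q)^l-1}$. Let $M_{n,h}(a,b,c,i,s)=(-q)^{n(h-i)+\frac{(i-s)(2n-i+s+1)}{2}-h^2+s(2n-2c-s)}(-1)^{i+h}\frac{P(n-i)}{P(n-h)P(h)}\cdot\frac{\prod_{l=s+1}^{h}(1-(-q)^{ -l})}{P(h-i)P(i-s)}\cdot\frac{P(c)P(b)}{P(c-i+s)P(b-s)}\cdot\mathcal C_{h+1-s}(a,b-s,c+s-i)$. For nonnegative $a,b,c$ with $a+b+c=n$ and $(a,b,c)\ne(0,t,n-t)$ for $t\le h-1$, $D_{n,h}(a,b,c)=\sum_{0\le s\le\min(h,b)}\sum_{s\le i\le\min(s+c,h)}M_{n,h}(a,b,c,i,s)$. -}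

module Defs where

open import Data.Nat as ℕ using (ℕ; zero; suc)
open import Data.Integer as ℤ using (ℤ; +_; -[1+_])
open import Data.Rational as ℚ using (ℚ; mkℚ; 0ℚ; 1ℚ; _+_; _*_; _-_; -_; 1/_)
open import Data.List using (List; []; _∷_; map; foldr; upTo)
open import Data.Nat.Primality using (Prime)
open import Data.Product using (∃; ∃-syntax; _×_)
open import Relation.Binary.PropositionalEquality using (_≡_; _≢_)

ι : ℕ → ℚ
ι n = (+ n) ℚ./ 1

-- total inverse (convention: inv 0 = 0; all denominators below are nonzero for q ≥ 3)
inv : ℚ → ℚ
inv p@(mkℚ (+ zero) _ _)    = 0ℚ
inv p@(mkℚ (+ suc _) _ _)   = 1/ p
inv p@(mkℚ -[1+ _ ] _ _)    = 1/ p

_÷_ : ℚ → ℚ → ℚ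
x ÷ y = x * inv y

powN : ℚ → ℕ → ℚ
powN x zero    = 1ℚ
powN x (suc k) = x * powN x k

powZ : ℚ → ℤ → ℚ
powZ x (+ k)      = powN x k
powZ x -[1+ k ]   = inv (powN x (suc k))

prodFromTo : ℕ → ℕ → (ℕ → ℚ) → ℚ
prodFromTo lo hi f = foldr (λ l acc → f (lo ℕ.+ l) * acc) 1ℚ (upTo (suc hi ℕ.∸ lo))

sumFromTo : ℕ → ℕ → (ℕ → ℚ) → ℚ
sumFromTo lo hi f = foldr (λ l acc → f (lo ℕ.+ l) + acc) 0ℚ (upTo (suc hi ℕ.∸ lo))

OddPrimePower : ℕ → Set
OddPrimePower q = ∃[ p ] ∃[ k ] (Prime p × p ≢ 2 × 1 ℕ.≤ k × q ≡ p ℕ.^ k)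

module _ (q : ℕ) where

  -mq : ℚ
  -mq = - ι q

  P : ℕ → ℚ
  P k = prodFromTo 1 k (λ l → 1ℚ - powZ -mq (ℤ.- (+ l)))

  𝒞 : ℤ → ℕ → ℕ → ℕ → ℚ
  𝒞 j zero zero c = sumFromTo 1 c (λ l → inv (powN -mq l - 1ℚ))
  𝒞 j a b c =
    powZ (- 1ℚ) (j ℤ.+ + 1) * prodFromTo 1 (a ℕ.+ b ℕ.∸ 1) (λ i → 1ℚ - powN -mq i)

  M : ℕ → ℕ → ℕ → ℕ → ℕ → ℕ → ℕ → ℚ
  M n h a b c i s =
    powZ -mq e
    * powN (- 1ℚ) (i ℕ.+ h)
    * (P (n ℕ.∸ i) ÷ (P (n ℕ.∸ h) * P h))
    * (prodFromTo (suc s) h (λ l → 1ℚ - powZ -mq (ℤ.- (+ l))) ÷ (P (h ℕ.∸ i) * P (i ℕ.∸ s)))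
    * ((P c * P b) ÷ (P (c ℕ.+ s ℕ.∸ i) * P (b ℕ.∸ s)))
    * 𝒞 (+ (h ℕ.+ 1 ℕ.∸ s)) a (b ℕ.∸ s) (c ℕ.+ s ℕ.∸ i)
    where
    -- exponent n(h-i) + (i-s)(2n-i+s+1)/2 - h^2 + s(2n-2c-s); on the summation
    -- range all natural subtractions below are exact and the product is even
    e : ℤ
    e = + (n ℕ.* (h ℕ.∸ i))
        ℤ.+ + (((i ℕ.∸ s) ℕ.* (2 ℕ.* n ℕ.∸ i ℕ.+ s ℕ.+ 1)) ℕ./ 2)
        ℤ.- + (h ℕ.* h)
        ℤ.+ (+ s) ℤ.* ((+ (2 ℕ.* n) ℤ.- + (2 ℕ.* c)) ℤ.- + s)

  D : ℕ → ℕ → ℕ → ℕ → ℕ → ℚ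
  D n h a b c =
    sumFromTo 0 (ℕ._⊓_ h b) (λ s →
      sumFromTo s (ℕ._⊓_ (s ℕ.+ c) h) (λ i → M n h a b c i s))

{-# OPTIONS --safe #-}
-- Fix s and put i = s + k, N = n - s, m = h - s and t = (-q)⁻¹. For a ≠ 0 the factor 𝒞 of M does
-- not depend on i, so the inner sum of D is a constant times
--   Σₖ (-1)ᵏ t^(k(k-1)/2) [c k]_t P(N-k)/P(m-k)      (taking c ≤ m; the case m ≤ c is symmetric).
-- The ratio P(N-k)/P(m-k) = ∏_{j<N-m} (1 - t^(m+1+j) (-q)ᵏ) is a polynomial of degree N - m in (-q)ᵏ,
-- while by the q-binomial theorem Σₖ (-1)ᵏ t^(k(k-1)/2) [c k]_t yᵏ = ∏_{r<c} (1 - y tʳ) vanishes at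
-- y = (-q)ʳ for every r < c. Hence the inner sum vanishes as soon as N - m < c, i.e. n - h < c.
module Submission where

open import Defs
open import Data.Nat using (ℕ; _+_; _∸_; _≤_; _<_)
open import Data.Rational using (0ℚ)
open import Relation.Binary.PropositionalEquality using (_≡_; _≢_)

open import Algebra.Properties.Group using (x∙y⁻¹≈ε⇒x≈y)
open import Data.Empty using (⊥-elim)
open import Data.Integer as ℤ using (ℤ; +_; -[1+_])
import Data.Integer.Properties as ℤ
open import Data.Integer.Tactic.RingSolver as ℤ using ()
open import Data.List using (foldr; applyUpTo)
open import Data.Nat as ℕ using (zero; suc; z≤n; s≤s; _⊓_)
import Data.Nat.Coprimality as Coprime
import Data.Nat.DivMod as ℕ
open import Data.Nat.Primality using (¬prime[0]; ¬prime[1])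
import Data.Nat.Properties as ℕ
open import Data.Nat.Tactic.RingSolver using (solve-∀)
open import Data.Product using (_,_)
open import Data.Rational as ℚ using (ℚ; mkℚ; 1ℚ; _*_; _-_; -_)
open import Data.Rational.Literals using (fromℤ)
import Data.Rational.Properties as ℚ
open import Data.Rational.Solver using (module +-*-Solver)
open import Data.Sum using (inj₁; inj₂)
open import Function using (_∘_)
open import Relation.Binary.PropositionalEquality using (refl; sym; trans; cong; cong₂; subst; module ≡-Reasoning)
open import Relation.Nullary using (yes; no)

open +-*-Solver using (solve; _:+_; _:*_; _:-_; :-_; con; _:=_)
open ≡-Reasoning

*-interchange : ∀ p q r s → (p * q) * (r * s) ≡ (p * r) * (q * s)
*-interchange = solve 4 (λ p q r s → (p :* q) :* (r :* s) := (p :* r) :* (q :* s)) refl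

inv-inverseʳ : ∀ {p} → p ≢ 0ℚ → p * inv p ≡ 1ℚ
inv-inverseʳ {mkℚ (+ zero) _ _}      p≢0 = ⊥-elim (ℕ.NonZero.nonZero (ℚ.≢-nonZero p≢0))
inv-inverseʳ {p@(mkℚ (+ suc _) _ _)} _   = ℚ.*-inverseʳ p
inv-inverseʳ {p@(mkℚ -[1+ _ ] _ _)}  _   = ℚ.*-inverseʳ p

inv-inverseˡ : ∀ {p} → p ≢ 0ℚ → inv p * p ≡ 1ℚ
inv-inverseˡ {p} p≢0 = trans (ℚ.*-comm (inv p) p) (inv-inverseʳ p≢0)

*-cancelˡ-inv : ∀ {p} → p ≢ 0ℚ → ∀ q → inv p * (p * q) ≡ q
*-cancelˡ-inv {p} p≢0 q = begin
  inv p * (p * q) ≡⟨ ℚ.*-assoc (inv p) p q ⟨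
  (inv p * p) * q ≡⟨ cong (_* q) (inv-inverseˡ p≢0) ⟩
  1ℚ * q          ≡⟨ ℚ.*-identityˡ q ⟩
  q               ∎

p*q≢0 : ∀ {p q} → p ≢ 0ℚ → q ≢ 0ℚ → p * q ≢ 0ℚ
p*q≢0 {p} {q} p≢0 q≢0 pq≡0 = q≢0 (begin
  q               ≡⟨ *-cancelˡ-inv p≢0 q ⟨
  inv p * (p * q) ≡⟨ cong (inv p *_) pq≡0 ⟩
  inv p * 0ℚ      ≡⟨ ℚ.*-zeroʳ (inv p) ⟩
  0ℚ              ∎)

inv-unique : ∀ {p r} → p * r ≡ 1ℚ → inv p ≡ r
inv-unique {p} {r} pr≡1 = begin
  inv p            ≡⟨ ℚ.*-identityʳ (inv p) ⟨
  inv p * 1ℚ       ≡⟨ cong (inv p *_) pr≡1 ⟨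
  inv p * (p * r)  ≡⟨ *-cancelˡ-inv p≢0 r ⟩
  r                ∎
  where
  p≢0 : p ≢ 0ℚ
  p≢0 refl = ℚ.1≢0 (trans (sym pr≡1) (ℚ.*-zeroˡ r))

inv-distrib-* : ∀ p q → inv (p * q) ≡ inv p * inv q
inv-distrib-* p q with p ℚ.≟ 0ℚ | q ℚ.≟ 0ℚ
... | yes refl | _        = trans (cong inv (ℚ.*-zeroˡ q)) (sym (ℚ.*-zeroˡ (inv q)))
... | no _     | yes refl = trans (cong inv (ℚ.*-zeroʳ p)) (sym (ℚ.*-zeroʳ (inv p)))
... | no p≢0   | no q≢0   = inv-unique {p * q} (begin
  (p * q) * (inv p * inv q) ≡⟨ *-interchange p q (inv p) (inv q) ⟩
  (p * inv p) * (q * inv q) ≡⟨ cong₂ _*_ (inv-inverseʳ p≢0) (inv-inverseʳ q≢0) ⟩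
  1ℚ                        ∎)

1-p≢0 : ∀ {p} → p ≢ 1ℚ → 1ℚ - p ≢ 0ℚ
1-p≢0 p≢1 1-p≡0 = p≢1 (sym (x∙y⁻¹≈ε⇒x≈y ℚ.+-0-group 1ℚ _ 1-p≡0))

powN-distribˡ-+-* : ∀ p m n → powN p (m + n) ≡ powN p m * powN p n
powN-distribˡ-+-* p zero    n = sym (ℚ.*-identityˡ (powN p n))
powN-distribˡ-+-* p (suc m) n =
  trans (cong (p *_) (powN-distribˡ-+-* p m n)) (sym (ℚ.*-assoc p (powN p m) (powN p n)))

powN-distribʳ-* : ∀ p q n → powN (p * q) n ≡ powN p n * powN q n
powN-distribʳ-* p q zero    = refl
powN-distribʳ-* p q (suc n) =
  trans (cong ((p * q) *_) (powN-distribʳ-* p q n)) (*-interchange p q (powN p n) (powN q n))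

powN-1ℚ : ∀ n → powN 1ℚ n ≡ 1ℚ
powN-1ℚ zero    = refl
powN-1ℚ (suc n) = trans (ℚ.*-identityˡ (powN 1ℚ n)) (powN-1ℚ n)

inv-powN : ∀ p n → inv (powN p n) ≡ powN (inv p) n
inv-powN p zero    = refl
inv-powN p (suc n) = trans (inv-distrib-* p (powN p n)) (cong (inv p *_) (inv-powN p n))

powZ-neg : ∀ p n → powZ p (ℤ.- (+ n)) ≡ inv (powN p n)
powZ-neg p zero    = refl
powZ-neg p (suc n) = refl

module _ {p : ℚ} (p≢0 : p ≢ 0ℚ) where

  powN-shift : ∀ m n → powN p m * inv (powN p n) ≡ powN p (suc m) * inv (powN p (suc n))
  powN-shift m n = sym (begin
    (p * powN p m) * inv (p * powN p n)        ≡⟨ cong ((p * powN p m) *_) (inv-distrib-* p (powN p n)) ⟩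
    (p * powN p m) * (inv p * inv (powN p n))  ≡⟨ *-interchange p (powN p m) (inv p) _ ⟩
    (p * inv p) * (powN p m * inv (powN p n))  ≡⟨ cong (_* (powN p m * inv (powN p n))) (inv-inverseʳ p≢0) ⟩
    1ℚ * (powN p m * inv (powN p n))           ≡⟨ ℚ.*-identityˡ _ ⟩
    powN p m * inv (powN p n)                  ∎)

  powZ-⊖ : ∀ m n → powZ p (m ℤ.⊖ n) ≡ powN p m * inv (powN p n)
  powZ-⊖ m       zero    = trans (cong (powZ p) (ℤ.⊖-≥ {m} z≤n)) (sym (ℚ.*-identityʳ (powN p m)))
  powZ-⊖ zero    (suc n) = trans (cong (powZ p) (ℤ.⊖-≤ {0} {suc n} z≤n)) (sym (ℚ.*-identityˡ _))
  powZ-⊖ (suc m) (suc n) =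
    trans (cong (powZ p) (ℤ.[1+m]⊖[1+n]≡m⊖n m n)) (trans (powZ-⊖ m n) (powN-shift m n))

  powZ-+ : ∀ i j → powZ p (i ℤ.+ j) ≡ powZ p i * powZ p j
  powZ-+ (+ m)    (+ n)    = powN-distribˡ-+-* p m n
  powZ-+ (+ m)    -[1+ n ] = powZ-⊖ m (suc n)
  powZ-+ -[1+ m ] (+ n)    = trans (powZ-⊖ n (suc m)) (ℚ.*-comm (powN p n) _)
  powZ-+ -[1+ m ] -[1+ n ] = begin
    inv (powN p (suc (suc (m + n))))       ≡⟨ cong (λ k → inv (powN p (suc k))) (ℕ.+-suc m n) ⟨
    inv (powN p (suc m + suc n))           ≡⟨ cong inv (powN-distribˡ-+-* p (suc m) (suc n)) ⟩
    inv (powN p (suc m) * powN p (suc n))  ≡⟨ inv-distrib-* (powN p (suc m)) (powN p (suc n)) ⟩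
    inv (powN p (suc m)) * inv (powN p (suc n)) ∎

∑< : ℕ → (ℕ → ℚ) → ℚ
∑< zero    f = 0ℚ
∑< (suc n) f = f 0 ℚ.+ ∑< n (f ∘ suc)

∏< : ℕ → (ℕ → ℚ) → ℚ
∏< zero    f = 1ℚ
∏< (suc n) f = f 0 * ∏< n (f ∘ suc)

syntax ∑< n (λ k → e) = ∑[ k < n ] e
syntax ∏< n (λ k → e) = ∏[ k < n ] e

foldr-+-applyUpTo : ∀ n (f : ℕ → ℚ) (g : ℕ → ℕ) →
                    foldr (λ l acc → f l ℚ.+ acc) 0ℚ (applyUpTo g n) ≡ ∑< n (f ∘ g)
foldr-+-applyUpTo zero    f g = refl
foldr-+-applyUpTo (suc n) f g = cong (f (g 0) ℚ.+_) (foldr-+-applyUpTo n f (g ∘ suc))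

foldr-*-applyUpTo : ∀ n (f : ℕ → ℚ) (g : ℕ → ℕ) →
                    foldr (λ l acc → f l * acc) 1ℚ (applyUpTo g n) ≡ ∏< n (f ∘ g)
foldr-*-applyUpTo zero    f g = refl
foldr-*-applyUpTo (suc n) f g = cong (f (g 0) *_) (foldr-*-applyUpTo n f (g ∘ suc))

sumFromTo≡∑ : ∀ lo hi f → sumFromTo lo hi f ≡ ∑[ l < suc hi ∸ lo ] f (lo + l)
sumFromTo≡∑ lo hi f = foldr-+-applyUpTo (suc hi ∸ lo) (λ l → f (lo + l)) (λ l → l)

prodFromTo≡∏ : ∀ lo hi f → prodFromTo lo hi f ≡ ∏[ l < suc hi ∸ lo ] f (lo + l)
prodFromTo≡∏ lo hi f = foldr-*-applyUpTo (suc hi ∸ lo) (λ l → f (lo + l)) (λ l → l)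

∑-cong : ∀ n {f g} → (∀ k → k < n → f k ≡ g k) → ∑< n f ≡ ∑< n g
∑-cong zero    f≡g = refl
∑-cong (suc n) f≡g = cong₂ ℚ._+_ (f≡g 0 (s≤s z≤n)) (∑-cong n (λ k k<n → f≡g (suc k) (s≤s k<n)))

∏-cong : ∀ n {f g} → (∀ k → k < n → f k ≡ g k) → ∏< n f ≡ ∏< n g
∏-cong zero    f≡g = refl
∏-cong (suc n) f≡g = cong₂ _*_ (f≡g 0 (s≤s z≤n)) (∏-cong n (λ k k<n → f≡g (suc k) (s≤s k<n)))

∑-0 : ∀ n → ∑[ k < n ] 0ℚ ≡ 0ℚ
∑-0 zero    = refl
∑-0 (suc n) = trans (ℚ.+-identityˡ _) (∑-0 n)

∑-distrib-+ : ∀ n f g → ∑[ k < n ] (f k ℚ.+ g k) ≡ ∑< n f ℚ.+ ∑< n g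
∑-distrib-+ zero    f g = refl
∑-distrib-+ (suc n) f g = trans (cong (f 0 ℚ.+ g 0 ℚ.+_) (∑-distrib-+ n (f ∘ suc) (g ∘ suc)))
  (solve 4 (λ a b c d → (a :+ b) :+ (c :+ d) := (a :+ c) :+ (b :+ d)) refl (f 0) (g 0) _ _)

*-distribˡ-∑ : ∀ n a f → a * ∑< n f ≡ ∑[ k < n ] (a * f k)
*-distribˡ-∑ zero    a f = ℚ.*-zeroʳ a
*-distribˡ-∑ (suc n) a f = trans (ℚ.*-distribˡ-+ a (f 0) _) (cong (a * f 0 ℚ.+_) (*-distribˡ-∑ n a (f ∘ suc)))

∑-last : ∀ n f → ∑< (suc n) f ≡ ∑< n f ℚ.+ f n
∑-last zero    f = ℚ.+-comm (f 0) 0ℚ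
∑-last (suc n) f = trans (cong (f 0 ℚ.+_) (∑-last n (f ∘ suc))) (sym (ℚ.+-assoc (f 0) _ _))

∏-last : ∀ n f → ∏< (suc n) f ≡ ∏< n f * f n
∏-last zero    f = ℚ.*-comm (f 0) 1ℚ
∏-last (suc n) f = trans (cong (f 0 *_) (∏-last n (f ∘ suc))) (sym (ℚ.*-assoc (f 0) _ _))

-- q-Pochhammer symbols, q-binomial coefficients and the q-binomial theorem

tri : ℕ → ℕ
tri zero    = 0
tri (suc k) = tri k + k

module QAnalysis (x : ℚ) (x≢0 : x ≢ 0ℚ) (x^suc≢1 : ∀ l → powN x (suc l) ≢ 1ℚ) where

  t : ℚ
  t = inv x

  t^k*x^k≡1 : ∀ k → powN t k * powN x k ≡ 1ℚ
  t^k*x^k≡1 k = begin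
    powN t k * powN x k  ≡⟨ powN-distribʳ-* t x k ⟨
    powN (t * x) k       ≡⟨ cong (λ y → powN y k) (inv-inverseˡ x≢0) ⟩
    powN 1ℚ k            ≡⟨ powN-1ℚ k ⟩
    1ℚ                   ∎

  1-t^suc≢0 : ∀ l → 1ℚ - powN t (suc l) ≢ 0ℚ
  1-t^suc≢0 l = 1-p≢0 {powN t (suc l)} λ t^l≡1 → x^suc≢1 l (begin
    powN x (suc l)                   ≡⟨ ℚ.*-identityˡ _ ⟨
    1ℚ * powN x (suc l)              ≡⟨ cong (_* powN x (suc l)) t^l≡1 ⟨
    powN t (suc l) * powN x (suc l)  ≡⟨ t^k*x^k≡1 (suc l) ⟩
    1ℚ                               ∎)

  -- The q-Pochhammer symbol (t; t)ₖ; for x = -q this is the paper's P(k), definitionally.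
  poch : ℕ → ℚ
  poch k = prodFromTo 1 k (λ l → 1ℚ - powZ x (ℤ.- (+ l)))

  poch≡∏ : ∀ k → poch k ≡ ∏[ l < k ] (1ℚ - powN t (suc l))
  poch≡∏ k = trans (prodFromTo≡∏ 1 k (λ l → 1ℚ - powZ x (ℤ.- (+ l))))
    (∏-cong k (λ l _ → cong (λ y → 1ℚ - y) (inv-powN x (suc l))))

  poch-suc : ∀ k → poch (suc k) ≡ poch k * (1ℚ - powN t (suc k))
  poch-suc k = begin
    poch (suc k)                                              ≡⟨ poch≡∏ (suc k) ⟩
    ∏[ l < suc k ] (1ℚ - powN t (suc l))                      ≡⟨ ∏-last k _ ⟩
    ∏[ l < k ] (1ℚ - powN t (suc l)) * (1ℚ - powN t (suc k))  ≡⟨ cong (_* (1ℚ - powN t (suc k))) (poch≡∏ k) ⟨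
    poch k * (1ℚ - powN t (suc k))                            ∎

  poch≢0 : ∀ k → poch k ≢ 0ℚ
  poch≢0 zero    = ℚ.1≢0
  poch≢0 (suc k) rewrite poch-suc k = p*q≢0 (poch≢0 k) (1-t^suc≢0 k)

  poch-+ : ∀ a d → poch (a + d) ≡ poch a * ∏[ j < d ] (1ℚ - powN t (suc (a + j)))
  poch-+ a zero    = trans (cong poch (ℕ.+-identityʳ a)) (sym (ℚ.*-identityʳ _))
  poch-+ a (suc d) = begin
    poch (a + suc d)                  ≡⟨ cong poch (ℕ.+-suc a d) ⟩
    poch (suc (a + d))                ≡⟨ poch-suc (a + d) ⟩
    poch (a + d) * u d                ≡⟨ cong (_* u d) (poch-+ a d) ⟩
    (poch a * ∏< d u) * u d           ≡⟨ ℚ.*-assoc (poch a) _ _ ⟩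
    poch a * (∏< d u * u d)           ≡⟨ cong (poch a *_) (∏-last d u) ⟨
    poch a * ∏< (suc d) u             ∎
    where
    u : ℕ → ℚ
    u j = 1ℚ - powN t (suc (a + j))

  qbinomial : ℕ → ℕ → ℚ
  qbinomial c       zero    = 1ℚ
  qbinomial zero    (suc k) = 0ℚ
  qbinomial (suc c) (suc k) = powN t (suc k) * qbinomial c (suc k) ℚ.+ qbinomial c k

  qbinomial-above : ∀ {c k} → c < k → qbinomial c k ≡ 0ℚ
  qbinomial-above {zero}  {suc k} _         = refl
  qbinomial-above {suc c} {suc k} (s≤s c<k) rewrite qbinomial-above (ℕ.m<n⇒m<1+n c<k) | qbinomial-above c<k =
    trans (cong (ℚ._+ 0ℚ) (ℚ.*-zeroʳ (powN t (suc k)))) (ℚ.+-identityʳ 0ℚ)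

  qbinomial-diag : ∀ c → qbinomial c c ≡ 1ℚ
  qbinomial-diag zero    = refl
  qbinomial-diag (suc c) rewrite qbinomial-above (ℕ.n<1+n c) | qbinomial-diag c =
    trans (cong (ℚ._+ 1ℚ) (ℚ.*-zeroʳ (powN t (suc c)))) (ℚ.+-identityˡ 1ℚ)

  qbinomial-poch : ∀ k j → qbinomial (k + j) k * poch k * poch j ≡ poch (k + j)
  qbinomial-poch zero    j = ℚ.*-identityˡ (poch j)
  qbinomial-poch (suc k) zero rewrite ℕ.+-identityʳ k | qbinomial-diag (suc k) =
    trans (ℚ.*-identityʳ _) (ℚ.*-identityˡ _)
  qbinomial-poch (suc k) (suc j) = begin
    (T₁ * Q₁ ℚ.+ Q₀) * poch (suc k) * poch (suc j)
      ≡⟨ cong₂ (λ a b → (T₁ * Q₁ ℚ.+ Q₀) * a * b) (poch-suc k) (poch-suc j) ⟩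
    (T₁ * Q₁ ℚ.+ Q₀) * (poch k * (1ℚ - T₁)) * (poch j * (1ℚ - T₂))
      ≡⟨ expand T₁ T₂ Q₁ Q₀ (poch k) (poch j) ⟩
    T₁ * (1ℚ - T₂) * (Q₁ * (poch k * (1ℚ - T₁)) * poch j) ℚ.+ (1ℚ - T₁) * (Q₀ * poch k * (poch j * (1ℚ - T₂)))
      ≡⟨ cong₂ (λ a b → T₁ * (1ℚ - T₂) * a ℚ.+ (1ℚ - T₁) * b) IH₁ IH₀ ⟩
    T₁ * (1ℚ - T₂) * S ℚ.+ (1ℚ - T₁) * S
      ≡⟨ collect T₁ T₂ S ⟩
    S * (1ℚ - T₁ * T₂)
      ≡⟨ cong (λ y → S * (1ℚ - y)) (powN-distribˡ-+-* t (suc k) (suc j)) ⟨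
    S * (1ℚ - powN t (suc k + suc j))
      ≡⟨ poch-suc (k + suc j) ⟨
    poch (suc k + suc j) ∎
    where
    T₁ = powN t (suc k)
    T₂ = powN t (suc j)
    Q₁ = qbinomial (k + suc j) (suc k)
    Q₀ = qbinomial (k + suc j) k
    S  = poch (k + suc j)
    IH₁ : Q₁ * (poch k * (1ℚ - T₁)) * poch j ≡ S
    IH₁ = trans (cong (λ a → Q₁ * a * poch j) (sym (poch-suc k)))
      (subst (λ c → qbinomial c (suc k) * poch (suc k) * poch j ≡ poch c) (sym (ℕ.+-suc k j)) (qbinomial-poch (suc k) j))
    IH₀ : Q₀ * poch k * (poch j * (1ℚ - T₂)) ≡ S
    IH₀ = trans (cong (λ a → Q₀ * poch k * a) (sym (poch-suc j))) (qbinomial-poch k (suc j))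
    expand : ∀ T₁ T₂ Q₁ Q₀ a b → (T₁ * Q₁ ℚ.+ Q₀) * (a * (1ℚ - T₁)) * (b * (1ℚ - T₂))
             ≡ T₁ * (1ℚ - T₂) * (Q₁ * (a * (1ℚ - T₁)) * b) ℚ.+ (1ℚ - T₁) * (Q₀ * a * (b * (1ℚ - T₂)))
    expand = solve 6 (λ T₁ T₂ Q₁ Q₀ a b →
      (T₁ :* Q₁ :+ Q₀) :* (a :* (con 1ℚ :- T₁)) :* (b :* (con 1ℚ :- T₂))
      := T₁ :* (con 1ℚ :- T₂) :* (Q₁ :* (a :* (con 1ℚ :- T₁)) :* b) :+ (con 1ℚ :- T₁) :* (Q₀ :* a :* (b :* (con 1ℚ :- T₂)))) refl
    collect : ∀ T₁ T₂ S → T₁ * (1ℚ - T₂) * S ℚ.+ (1ℚ - T₁) * S ≡ S * (1ℚ - T₁ * T₂)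
    collect = solve 3 (λ T₁ T₂ S → T₁ :* (con 1ℚ :- T₂) :* S :+ (con 1ℚ :- T₁) :* S := S :* (con 1ℚ :- T₁ :* T₂)) refl

  inv-poch-split : ∀ {c k} → k ≤ c → inv (poch k) * inv (poch (c ∸ k)) ≡ qbinomial c k * inv (poch c)
  inv-poch-split {c} {k} k≤c = begin
    inv (poch k) * inv (poch (c ∸ k))  ≡⟨ inv-distrib-* (poch k) (poch (c ∸ k)) ⟨
    inv (poch k * poch (c ∸ k))        ≡⟨ inv-unique {poch k * poch (c ∸ k)} (begin
      poch k * poch (c ∸ k) * (qbinomial c k * inv (poch c))
        ≡⟨ regroup (poch k) (poch (c ∸ k)) (qbinomial c k) (inv (poch c)) ⟩
      qbinomial c k * poch k * poch (c ∸ k) * inv (poch c)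
        ≡⟨ cong (_* inv (poch c)) split ⟩
      poch c * inv (poch c)
        ≡⟨ inv-inverseʳ (poch≢0 c) ⟩
      1ℚ ∎) ⟩
    qbinomial c k * inv (poch c)       ∎
    where
    split : qbinomial c k * poch k * poch (c ∸ k) ≡ poch c
    split = subst (λ z → qbinomial z k * poch k * poch (c ∸ k) ≡ poch z) (ℕ.m+[n∸m]≡n k≤c)
                  (qbinomial-poch k (c ∸ k))
    regroup : ∀ a b q i → a * b * (q * i) ≡ q * a * b * i
    regroup = solve 4 (λ a b q i → a :* b :* (q :* i) := q :* a :* b :* i) refl

  rotheCoeff : ℕ → ℚ
  rotheCoeff k = powN (- 1ℚ) k * powN t (tri k)

  rotheCoeff-suc : ∀ k → rotheCoeff (suc k) ≡ - powN t k * rotheCoeff k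
  rotheCoeff-suc k = begin
    (- 1ℚ * powN (- 1ℚ) k) * powN t (tri k + k)          ≡⟨ cong ((- 1ℚ * powN (- 1ℚ) k) *_) (powN-distribˡ-+-* t (tri k) k) ⟩
    (- 1ℚ * powN (- 1ℚ) k) * (powN t (tri k) * powN t k)  ≡⟨ regroup (powN (- 1ℚ) k) (powN t (tri k)) (powN t k) ⟩
    - powN t k * rotheCoeff k                             ∎
    where
    regroup : ∀ s p r → (- 1ℚ * s) * (p * r) ≡ - r * (s * p)
    regroup = solve 3 (λ s p r → (:- con 1ℚ :* s) :* (p :* r) := :- r :* (s :* p)) refl

  rotheTerm : ℕ → ℚ → ℕ → ℚ
  rotheTerm c y k = rotheCoeff k * qbinomial c k * powN y k

  -- By the q-binomial theorem this is ∏_{r<c} (1 - y tʳ); rotheSum-suc below is that identity in recursive form.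
  rotheSum : ℕ → ℚ → ℚ
  rotheSum c y = ∑< (suc c) (rotheTerm c y)

  rotheTerm-pascal : ∀ c y k →
    rotheTerm (suc c) y (suc k) ≡ rotheTerm c (y * t) (suc k) ℚ.+ - y * rotheTerm c (y * t) k
  rotheTerm-pascal c y k = begin
    rotheCoeff (suc k) * (powN t (suc k) * Q₁ ℚ.+ Q₀) * (y * powN y k)
      ≡⟨ cong (λ a → a * (powN t (suc k) * Q₁ ℚ.+ Q₀) * (y * powN y k)) (rotheCoeff-suc k) ⟩
    (- powN t k * rotheCoeff k) * ((t * powN t k) * Q₁ ℚ.+ Q₀) * (y * powN y k)
      ≡⟨ expand (rotheCoeff k) (powN t k) (powN y k) y t Q₁ Q₀ ⟩
    (- powN t k * rotheCoeff k) * Q₁ * ((y * t) * (powN y k * powN t k)) ℚ.+ - y * (rotheCoeff k * Q₀ * (powN y k * powN t k))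
      ≡⟨ cong₂ (λ a b → a * Q₁ * ((y * t) * b) ℚ.+ - y * (rotheCoeff k * Q₀ * b))
               (sym (rotheCoeff-suc k)) (sym (powN-distribʳ-* y t k)) ⟩
    rotheTerm c (y * t) (suc k) ℚ.+ - y * rotheTerm c (y * t) k ∎
    where
    Q₁ = qbinomial c (suc k)
    Q₀ = qbinomial c k
    expand : ∀ A τ η y t Q₁ Q₀ → (- τ * A) * ((t * τ) * Q₁ ℚ.+ Q₀) * (y * η)
             ≡ (- τ * A) * Q₁ * ((y * t) * (η * τ)) ℚ.+ - y * (A * Q₀ * (η * τ))
    expand = solve 7 (λ A τ η y t Q₁ Q₀ → (:- τ :* A) :* ((t :* τ) :* Q₁ :+ Q₀) :* (y :* η)
                      := (:- τ :* A) :* Q₁ :* ((y :* t) :* (η :* τ)) :+ :- y :* (A :* Q₀ :* (η :* τ))) refl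

  rotheSum-suc : ∀ c y → rotheSum (suc c) y ≡ (1ℚ - y) * rotheSum c (y * t)
  rotheSum-suc c y = begin
    F 0 ℚ.+ ∑< (suc c) (F ∘ suc)
      ≡⟨ cong (F 0 ℚ.+_) (∑-cong (suc c) (λ k _ → rotheTerm-pascal c y k)) ⟩
    F 0 ℚ.+ ∑[ k < suc c ] (f (suc k) ℚ.+ - y * f k)
      ≡⟨ cong (F 0 ℚ.+_) (∑-distrib-+ (suc c) (f ∘ suc) (λ k → - y * f k)) ⟩
    F 0 ℚ.+ (∑< (suc c) (f ∘ suc) ℚ.+ ∑[ k < suc c ] (- y * f k))
      ≡⟨ cong (λ s → F 0 ℚ.+ (∑< (suc c) (f ∘ suc) ℚ.+ s)) (*-distribˡ-∑ (suc c) (- y) f) ⟨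
    F 0 ℚ.+ (∑< (suc c) (f ∘ suc) ℚ.+ - y * G)
      ≡⟨ ℚ.+-assoc (F 0) (∑< (suc c) (f ∘ suc)) (- y * G) ⟨
    ∑< (suc (suc c)) f ℚ.+ - y * G
      ≡⟨ cong (ℚ._+ - y * G) (∑-last (suc c) f) ⟩
    (G ℚ.+ f (suc c)) ℚ.+ - y * G
      ≡⟨ cong (λ q → (G ℚ.+ rotheCoeff (suc c) * q * powN (y * t) (suc c)) ℚ.+ - y * G) (qbinomial-above (ℕ.n<1+n c)) ⟩
    (G ℚ.+ rotheCoeff (suc c) * 0ℚ * powN (y * t) (suc c)) ℚ.+ - y * G
      ≡⟨ collect G (rotheCoeff (suc c)) (powN (y * t) (suc c)) y ⟩
    (1ℚ - y) * G ∎
    where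
    F = rotheTerm (suc c) y
    f = rotheTerm c (y * t)
    G = rotheSum c (y * t)
    collect : ∀ G a p y → (G ℚ.+ a * 0ℚ * p) ℚ.+ - y * G ≡ (1ℚ - y) * G
    collect = solve 4 (λ G a p y → (G :+ a :* con 0ℚ :* p) :+ :- y :* G := (con 1ℚ :- y) :* G) refl

  rotheSum-powN-x : ∀ {c r} → r < c → rotheSum c (powN x r) ≡ 0ℚ
  rotheSum-powN-x {suc c} {zero}  _ = begin
    rotheSum (suc c) 1ℚ                ≡⟨ rotheSum-suc c 1ℚ ⟩
    (1ℚ - 1ℚ) * rotheSum c (1ℚ * t)    ≡⟨ ℚ.*-zeroˡ (rotheSum c (1ℚ * t)) ⟩
    0ℚ                                 ∎
  rotheSum-powN-x {suc c} {suc r} (s≤s r<c) = begin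
    rotheSum (suc c) (powN x (suc r))                          ≡⟨ rotheSum-suc c (powN x (suc r)) ⟩
    (1ℚ - powN x (suc r)) * rotheSum c ((x * powN x r) * t)   ≡⟨ cong (λ y → (1ℚ - powN x (suc r)) * rotheSum c y) x*y*t≡y ⟩
    (1ℚ - powN x (suc r)) * rotheSum c (powN x r)             ≡⟨ cong ((1ℚ - powN x (suc r)) *_) (rotheSum-powN-x r<c) ⟩
    (1ℚ - powN x (suc r)) * 0ℚ                                ≡⟨ ℚ.*-zeroʳ (1ℚ - powN x (suc r)) ⟩
    0ℚ                                                        ∎
    where
    x*y*t≡y : (x * powN x r) * t ≡ powN x r
    x*y*t≡y = begin
      (x * powN x r) * t  ≡⟨ ℚ.*-comm (x * powN x r) t ⟩
      t * (x * powN x r)  ≡⟨ *-cancelˡ-inv x≢0 (powN x r) ⟩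
      powN x r            ∎

  rotheSumWeighted : ℕ → ℚ → ℕ → (ℕ → ℚ) → ℚ
  rotheSumWeighted c y d u = ∑[ k < suc c ] (rotheTerm c y k * ∏[ j < d ] (1ℚ - u j * powN x k))

  -- The weight is a polynomial of degree d in xᵏ, a combination of the sequences (xʳ)ᵏ with
  -- r ≤ d, each of which is annihilated by rotheSum-powN-x when d < c.
  rotheSumWeighted≡0 : ∀ d (u : ℕ → ℚ) {c r} → r + d < c → rotheSumWeighted c (powN x r) d u ≡ 0ℚ
  rotheSumWeighted≡0 zero    u {c} {r} r<c =
    trans (∑-cong (suc c) {g = rotheTerm c (powN x r)} (λ k _ → ℚ.*-identityʳ _))
          (rotheSum-powN-x (subst (_< c) (ℕ.+-identityʳ r) r<c))
  rotheSumWeighted≡0 (suc d) u {c} {r} r+d<c = begin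
    rotheSumWeighted c (powN x r) (suc d) u
      ≡⟨ ∑-cong (suc c) (λ k _ → split k) ⟩
    ∑[ k < suc c ] (term r k ℚ.+ - u 0 * term (suc r) k)
      ≡⟨ ∑-distrib-+ (suc c) (term r) (λ k → - u 0 * term (suc r) k) ⟩
    ∑< (suc c) (term r) ℚ.+ ∑[ k < suc c ] (- u 0 * term (suc r) k)
      ≡⟨ cong (∑< (suc c) (term r) ℚ.+_) (*-distribˡ-∑ (suc c) (- u 0) (term (suc r))) ⟨
    ∑< (suc c) (term r) ℚ.+ - u 0 * ∑< (suc c) (term (suc r))
      ≡⟨ cong₂ (λ a b → a ℚ.+ - u 0 * b) (rotheSumWeighted≡0 d v r+d<c′) (rotheSumWeighted≡0 d v r+1+d<c) ⟩
    0ℚ ℚ.+ - u 0 * 0ℚ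
      ≡⟨ trans (ℚ.+-identityˡ (- u 0 * 0ℚ)) (ℚ.*-zeroʳ (- u 0)) ⟩
    0ℚ ∎
    where
    v : ℕ → ℚ
    v j = u (suc j)
    Π : ℕ → ℚ
    Π k = ∏[ j < d ] (1ℚ - v j * powN x k)
    term : ℕ → ℕ → ℚ
    term r k = rotheTerm c (powN x r) k * Π k
    r+d<c′ : r + d < c
    r+d<c′ = ℕ.<-trans (ℕ.+-monoʳ-< r (ℕ.n<1+n d)) r+d<c
    r+1+d<c : suc r + d < c
    r+1+d<c = subst (_< c) (ℕ.+-suc r d) r+d<c
    split : ∀ k → rotheTerm c (powN x r) k * ((1ℚ - u 0 * powN x k) * Π k) ≡ term r k ℚ.+ - u 0 * term (suc r) k
    split k = trans (expand (rotheCoeff k * qbinomial c k) (powN (powN x r) k) (powN x k) (u 0) (Π k))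
      (cong (λ y → term r k ℚ.+ - u 0 * (rotheCoeff k * qbinomial c k * y * Π k))
            (sym (powN-distribʳ-* x (powN x r) k)))
      where
      expand : ∀ A Y X u₀ P → A * Y * ((1ℚ - u₀ * X) * P) ≡ A * Y * P ℚ.+ - u₀ * (A * (X * Y) * P)
      expand = solve 5 (λ A Y X u₀ P → A :* Y :* ((con 1ℚ :- u₀ :* X) :* P)
                       := A :* Y :* P :+ :- u₀ :* (A :* (X :* Y) :* P)) refl

  t^suc[m∸k+j] : ∀ {m k} j → k ≤ m → powN t (suc (m ∸ k + j)) ≡ powN t (suc (m + j)) * powN x k
  t^suc[m∸k+j] {m} {k} j k≤m = sym (begin
    powN t (suc (m + j)) * powN x k                         ≡⟨ cong (λ e → powN t e * powN x k) exponent ⟩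
    powN t (suc (m ∸ k + j) + k) * powN x k                 ≡⟨ cong (_* powN x k) (powN-distribˡ-+-* t (suc (m ∸ k + j)) k) ⟩
    (powN t (suc (m ∸ k + j)) * powN t k) * powN x k        ≡⟨ ℚ.*-assoc (powN t (suc (m ∸ k + j))) (powN t k) (powN x k) ⟩
    powN t (suc (m ∸ k + j)) * (powN t k * powN x k)        ≡⟨ cong (powN t (suc (m ∸ k + j)) *_) (t^k*x^k≡1 k) ⟩
    powN t (suc (m ∸ k + j)) * 1ℚ                           ≡⟨ ℚ.*-identityʳ _ ⟩
    powN t (suc (m ∸ k + j))                                ∎)
    where
    shuffle : ∀ a j k → suc (a + k + j) ≡ suc (a + j) + k
    shuffle = solve-∀
    exponent : suc (m + j) ≡ suc (m ∸ k + j) + k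
    exponent = trans (cong (λ a → suc (a + j)) (sym (ℕ.m∸n+n≡m k≤m))) (shuffle (m ∸ k) j k)

  poch-ratio : ∀ {N m k} → k ≤ m → m ≤ N →
    poch (N ∸ k) * inv (poch (m ∸ k)) ≡ ∏[ j < N ∸ m ] (1ℚ - powN t (suc (m + j)) * powN x k)
  poch-ratio {N} {m} {k} k≤m m≤N = begin
    poch (N ∸ k) * inv (poch (m ∸ k))
      ≡⟨ cong (λ n → poch n * inv (poch (m ∸ k))) N∸k≡m∸k+[N∸m] ⟩
    poch (m ∸ k + (N ∸ m)) * inv (poch (m ∸ k))
      ≡⟨ cong (_* inv (poch (m ∸ k))) (poch-+ (m ∸ k) (N ∸ m)) ⟩
    (poch (m ∸ k) * ∏[ j < N ∸ m ] (1ℚ - powN t (suc (m ∸ k + j)))) * inv (poch (m ∸ k))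
      ≡⟨ ℚ.*-comm (poch (m ∸ k) * _) (inv (poch (m ∸ k))) ⟩
    inv (poch (m ∸ k)) * (poch (m ∸ k) * ∏[ j < N ∸ m ] (1ℚ - powN t (suc (m ∸ k + j))))
      ≡⟨ *-cancelˡ-inv (poch≢0 (m ∸ k)) _ ⟩
    ∏[ j < N ∸ m ] (1ℚ - powN t (suc (m ∸ k + j)))
      ≡⟨ ∏-cong (N ∸ m) (λ j _ → cong (λ y → 1ℚ - y) (t^suc[m∸k+j] j k≤m)) ⟩
    ∏[ j < N ∸ m ] (1ℚ - powN t (suc (m + j)) * powN x k) ∎
    where
    N∸k≡m∸k+[N∸m] : N ∸ k ≡ m ∸ k + (N ∸ m)
    N∸k≡m∸k+[N∸m] = trans (cong (_∸ k) (sym (ℕ.m+[n∸m]≡n m≤N))) (ℕ.+-∸-comm (N ∸ m) k≤m)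

  -- The i-dependent factor of the paper's M at i = s + k, with N = n - s and m = h - s.
  weight : ℕ → ℕ → ℕ → ℕ → ℚ
  weight N m c k =
    powN (- 1ℚ) k * inv (powN x (tri k)) * poch (N ∸ k) * inv (poch (m ∸ k)) * inv (poch k) * inv (poch (c ∸ k))

  weight≡rotheTerm : ∀ {N m c k} → k ≤ c → c ≤ m → m ≤ N →
    weight N m c k ≡ inv (poch c) * (rotheTerm c 1ℚ k * ∏[ j < N ∸ m ] (1ℚ - powN t (suc (m + j)) * powN x k))
  weight≡rotheTerm {N} {m} {c} {k} k≤c c≤m m≤N = begin
    weight N m c k
      ≡⟨ regroup (powN (- 1ℚ) k) (inv (powN x (tri k))) (poch (N ∸ k)) (inv (poch (m ∸ k))) (inv (poch k)) (inv (poch (c ∸ k))) ⟩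
    (powN (- 1ℚ) k * inv (powN x (tri k))) * (poch (N ∸ k) * inv (poch (m ∸ k))) * (inv (poch k) * inv (poch (c ∸ k)))
      ≡⟨ cong₂ (λ a b → (powN (- 1ℚ) k * a) * b * (inv (poch k) * inv (poch (c ∸ k))))
               (inv-powN x (tri k)) (poch-ratio (ℕ.≤-trans k≤c c≤m) m≤N) ⟩
    rotheCoeff k * Π * (inv (poch k) * inv (poch (c ∸ k)))
      ≡⟨ cong (rotheCoeff k * Π *_) (inv-poch-split k≤c) ⟩
    rotheCoeff k * Π * (qbinomial c k * inv (poch c))
      ≡⟨ move (rotheCoeff k) Π (qbinomial c k) (inv (poch c)) ⟩
    inv (poch c) * (rotheCoeff k * qbinomial c k * 1ℚ * Π)
      ≡⟨ cong (λ y → inv (poch c) * (rotheCoeff k * qbinomial c k * y * Π)) (powN-1ℚ k) ⟨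
    inv (poch c) * (rotheTerm c 1ℚ k * Π) ∎
    where
    Π = ∏[ j < N ∸ m ] (1ℚ - powN t (suc (m + j)) * powN x k)
    regroup : ∀ a b c d e f → a * b * c * d * e * f ≡ (a * b) * (c * d) * (e * f)
    regroup = solve 6 (λ a b c d e f → a :* b :* c :* d :* e :* f := (a :* b) :* (c :* d) :* (e :* f)) refl
    move : ∀ a p q i → a * p * (q * i) ≡ i * (a * q * 1ℚ * p)
    move = solve 4 (λ a p q i → a :* p :* (q :* i) := i :* (a :* q :* con 1ℚ :* p)) refl

  ∑-weight≡0 : ∀ {N m c} → c ≤ m → m ≤ N → N < m + c → ∑< (suc c) (weight N m c) ≡ 0ℚ
  ∑-weight≡0 {N} {m} {c} c≤m m≤N N<m+c = begin
    ∑< (suc c) (weight N m c)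
      ≡⟨ ∑-cong (suc c) (λ k k≤c → weight≡rotheTerm (ℕ.≤-pred k≤c) c≤m m≤N) ⟩
    ∑[ k < suc c ] (inv (poch c) * (rotheTerm c 1ℚ k * ∏[ j < N ∸ m ] (1ℚ - u j * powN x k)))
      ≡⟨ *-distribˡ-∑ (suc c) (inv (poch c)) (λ k → rotheTerm c 1ℚ k * ∏[ j < N ∸ m ] (1ℚ - u j * powN x k)) ⟨
    inv (poch c) * rotheSumWeighted c 1ℚ (N ∸ m) u
      ≡⟨ cong (inv (poch c) *_) (rotheSumWeighted≡0 (N ∸ m) u {c} {0} N∸m<c) ⟩
    inv (poch c) * 0ℚ
      ≡⟨ ℚ.*-zeroʳ (inv (poch c)) ⟩
    0ℚ ∎
    where
    u : ℕ → ℚ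
    u j = powN t (suc (m + j))
    N∸m<c : N ∸ m < c
    N∸m<c = ℕ.+-cancelˡ-< m (N ∸ m) c (subst (_< m + c) (sym (ℕ.m+[n∸m]≡n m≤N)) N<m+c)

  weight-comm : ∀ N m c k → weight N m c k ≡ weight N c m k
  weight-comm N m c k = swap (powN (- 1ℚ) k) (inv (powN x (tri k))) (poch (N ∸ k)) (inv (poch (m ∸ k))) (inv (poch k)) (inv (poch (c ∸ k)))
    where
    swap : ∀ a b c d e f → a * b * c * d * e * f ≡ a * b * c * f * e * d
    swap = solve 6 (λ a b c d e f → a :* b :* c :* d :* e :* f := a :* b :* c :* f :* e :* d) refl

  ∑-weight-up-to-min≡0 : ∀ {N m c} → m ≤ N → c ≤ N → N < m + c → ∑< (suc (c ⊓ m)) (weight N m c) ≡ 0ℚ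
  ∑-weight-up-to-min≡0 {N} {m} {c} m≤N c≤N N<m+c with ℕ.≤-total c m
  ... | inj₁ c≤m rewrite ℕ.m≤n⇒m⊓n≡m c≤m = ∑-weight≡0 c≤m m≤N N<m+c
  ... | inj₂ m≤c rewrite ℕ.m≥n⇒m⊓n≡n m≤c =
    trans (∑-cong (suc m) (λ k _ → weight-comm N m c k)) (∑-weight≡0 m≤c c≤N (subst (N <_) (ℕ.+-comm m c) N<m+c))

-- The exponent of -q in M

tri*2+k≡k*k : ∀ k → tri k ℕ.* 2 + k ≡ k ℕ.* k
tri*2+k≡k*k zero    = refl
tri*2+k≡k*k (suc k) = begin
  (tri k + k) ℕ.* 2 + suc k       ≡⟨ regroup (tri k) k ⟩
  (tri k ℕ.* 2 + k) + (k + suc k) ≡⟨ cong (_+ (k + suc k)) (tri*2+k≡k*k k) ⟩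
  k ℕ.* k + (k + suc k)           ≡⟨ square k ⟩
  suc k ℕ.* suc k                 ∎
  where
  regroup : ∀ T k → (T + k) ℕ.* 2 + suc k ≡ (T ℕ.* 2 + k) + (k + suc k)
  regroup = solve-∀
  square : ∀ k → k ℕ.* k + (k + suc k) ≡ suc k ℕ.* suc k
  square = solve-∀

-- k(2n - k + 1)/2 = kn - k(k-1)/2, with both sides moved so that no subtraction remains.
half[k*[2n∸k+1]]+tri≡k*n : ∀ {k n} → k ≤ n → (k ℕ.* (2 ℕ.* n ∸ k + 1)) ℕ./ 2 + tri k ≡ k ℕ.* n
half[k*[2n∸k+1]]+tri≡k*n {k} {n} k≤n = begin
  (k ℕ.* (2 ℕ.* n ∸ k + 1)) ℕ./ 2 + tri k
    ≡⟨ cong (λ m → (k ℕ.* (m + 1)) ℕ./ 2 + tri k) 2n∸k≡k+2w ⟩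
  (k ℕ.* (k + 2 ℕ.* w + 1)) ℕ./ 2 + tri k
    ≡⟨ cong (λ m → m ℕ./ 2 + tri k) numerator ⟩
  ((T + k ℕ.* suc w) ℕ.* 2) ℕ./ 2 + T
    ≡⟨ cong (_+ T) (ℕ.m*n/n≡m (T + k ℕ.* suc w) 2) ⟩
  T + k ℕ.* suc w + T
    ≡⟨ regroup₂ T k w ⟩
  (T ℕ.* 2 + k) + k ℕ.* w
    ≡⟨ cong (_+ k ℕ.* w) (tri*2+k≡k*k k) ⟩
  k ℕ.* k + k ℕ.* w
    ≡⟨ ℕ.*-distribˡ-+ k k w ⟨
  k ℕ.* (k + w)
    ≡⟨ cong (k ℕ.*_) (ℕ.m+[n∸m]≡n k≤n) ⟩
  k ℕ.* n ∎
  where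
  w = n ∸ k
  T = tri k
  2n∸k≡k+2w : 2 ℕ.* n ∸ k ≡ k + 2 ℕ.* w
  2n∸k≡k+2w = begin
    2 ℕ.* n ∸ k                ≡⟨ cong (λ m → 2 ℕ.* m ∸ k) (ℕ.m+[n∸m]≡n k≤n) ⟨
    2 ℕ.* (k + w) ∸ k          ≡⟨ cong (_∸ k) (double k w) ⟩
    k + (k + 2 ℕ.* w) ∸ k      ≡⟨ ℕ.m+n∸m≡n k (k + 2 ℕ.* w) ⟩
    k + 2 ℕ.* w                ∎
    where
    double : ∀ k w → 2 ℕ.* (k + w) ≡ k + (k + 2 ℕ.* w)
    double = solve-∀
  numerator : k ℕ.* (k + 2 ℕ.* w + 1) ≡ (T + k ℕ.* suc w) ℕ.* 2
  numerator = begin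
    k ℕ.* (k + 2 ℕ.* w + 1)              ≡⟨ regroup₁ k w ⟩
    k ℕ.* k + k ℕ.* (2 ℕ.* w + 1)        ≡⟨ cong (_+ k ℕ.* (2 ℕ.* w + 1)) (tri*2+k≡k*k k) ⟨
    (T ℕ.* 2 + k) + k ℕ.* (2 ℕ.* w + 1)  ≡⟨ regroup₃ T k w ⟩
    (T + k ℕ.* suc w) ℕ.* 2              ∎
    where
    regroup₁ : ∀ k w → k ℕ.* (k + 2 ℕ.* w + 1) ≡ k ℕ.* k + k ℕ.* (2 ℕ.* w + 1)
    regroup₁ = solve-∀
    regroup₃ : ∀ T k w → (T ℕ.* 2 + k) + k ℕ.* (2 ℕ.* w + 1) ≡ (T + k ℕ.* suc w) ℕ.* 2
    regroup₃ = solve-∀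
  regroup₂ : ∀ T k w → T + k ℕ.* suc w + T ≡ (T ℕ.* 2 + k) + k ℕ.* w
  regroup₂ = solve-∀

exponent-shift-ℕ : ∀ {n h s k} → s + k ≤ h → h ≤ n →
  n ℕ.* (h ∸ (s + k)) + ((s + k ∸ s) ℕ.* (2 ℕ.* n ∸ (s + k) + s + 1)) ℕ./ 2 + tri k ≡ n ℕ.* (h ∸ s)
exponent-shift-ℕ {n} {h} {s} {k} s+k≤h h≤n = begin
  n ℕ.* (h ∸ (s + k)) + ((s + k ∸ s) ℕ.* (2 ℕ.* n ∸ (s + k) + s + 1)) ℕ./ 2 + tri k
    ≡⟨ cong₂ (λ a b → n ℕ.* (h ∸ (s + k)) + (a ℕ.* (b + 1)) ℕ./ 2 + tri k) (ℕ.m+n∸m≡n s k) 2n∸[s+k]+s≡2n∸k ⟩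
  n ℕ.* (h ∸ (s + k)) + (k ℕ.* (2 ℕ.* n ∸ k + 1)) ℕ./ 2 + tri k
    ≡⟨ ℕ.+-assoc (n ℕ.* (h ∸ (s + k))) ((k ℕ.* (2 ℕ.* n ∸ k + 1)) ℕ./ 2) (tri k) ⟩
  n ℕ.* (h ∸ (s + k)) + ((k ℕ.* (2 ℕ.* n ∸ k + 1)) ℕ./ 2 + tri k)
    ≡⟨ cong (λ m → n ℕ.* (h ∸ (s + k)) + m) (trans (half[k*[2n∸k+1]]+tri≡k*n k≤n) (ℕ.*-comm k n)) ⟩
  n ℕ.* (h ∸ (s + k)) + n ℕ.* k
    ≡⟨ ℕ.*-distribˡ-+ n (h ∸ (s + k)) k ⟨
  n ℕ.* (h ∸ (s + k) + k)
    ≡⟨ cong (n ℕ.*_) h∸[s+k]+k≡h∸s ⟩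
  n ℕ.* (h ∸ s) ∎
  where
  k≤h∸s : k ≤ h ∸ s
  k≤h∸s = ℕ.m+n≤o⇒m≤o∸n k (ℕ.≤-trans (ℕ.≤-reflexive (ℕ.+-comm k s)) s+k≤h)
  k≤n : k ≤ n
  k≤n = ℕ.≤-trans (ℕ.m+n≤o⇒n≤o s s+k≤h) h≤n
  s≤2n∸k : s ≤ 2 ℕ.* n ∸ k
  s≤2n∸k = ℕ.m+n≤o⇒m≤o∸n s (ℕ.≤-trans s+k≤h (ℕ.≤-trans h≤n (ℕ.m≤m+n n (n + 0))))
  2n∸[s+k]+s≡2n∸k : 2 ℕ.* n ∸ (s + k) + s ≡ 2 ℕ.* n ∸ k
  2n∸[s+k]+s≡2n∸k = begin
    2 ℕ.* n ∸ (s + k) + s   ≡⟨ cong (λ m → 2 ℕ.* n ∸ m + s) (ℕ.+-comm s k) ⟩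
    2 ℕ.* n ∸ (k + s) + s   ≡⟨ cong (_+ s) (ℕ.∸-+-assoc (2 ℕ.* n) k s) ⟨
    2 ℕ.* n ∸ k ∸ s + s     ≡⟨ ℕ.m∸n+n≡m s≤2n∸k ⟩
    2 ℕ.* n ∸ k             ∎
  h∸[s+k]+k≡h∸s : h ∸ (s + k) + k ≡ h ∸ s
  h∸[s+k]+k≡h∸s = trans (cong (_+ k) (sym (ℕ.∸-+-assoc h s k))) (ℕ.m∸n+n≡m k≤h∸s)

-- The exponent e from the where block of M.
exponentM : ℕ → ℕ → ℕ → ℕ → ℕ → ℤ
exponentM n h c i s =
  + (n ℕ.* (h ∸ i)) ℤ.+ + (((i ∸ s) ℕ.* (2 ℕ.* n ∸ i + s + 1)) ℕ./ 2) ℤ.- + (h ℕ.* h)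
  ℤ.+ (+ s) ℤ.* ((+ (2 ℕ.* n) ℤ.- + (2 ℕ.* c)) ℤ.- + s)

exponentM-base : ℕ → ℕ → ℕ → ℕ → ℤ
exponentM-base n h c s = + (n ℕ.* (h ∸ s)) ℤ.- + (h ℕ.* h) ℤ.+ (+ s) ℤ.* ((+ (2 ℕ.* n) ℤ.- + (2 ℕ.* c)) ℤ.- + s)

exponentM-shift : ∀ {n h c s k} → s + k ≤ h → h ≤ n →
  exponentM n h c (s + k) s ≡ exponentM-base n h c s ℤ.- + tri k
exponentM-shift {n} {h} {c} {s} {k} s+k≤h h≤n = begin
  + A ℤ.+ + B ℤ.- H ℤ.+ Σₛ
    ≡⟨ cong (λ z → z ℤ.- H ℤ.+ Σₛ) (ℤ.pos-+ A B) ⟨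
  + (A + B) ℤ.- H ℤ.+ Σₛ
    ≡⟨ regroup (+ (A + B)) H Σₛ (+ tri k) ⟩
  (+ (A + B) ℤ.+ + tri k) ℤ.- H ℤ.+ Σₛ ℤ.- + tri k
    ≡⟨ cong (λ z → z ℤ.- H ℤ.+ Σₛ ℤ.- + tri k) (ℤ.pos-+ (A + B) (tri k)) ⟨
  + (A + B + tri k) ℤ.- H ℤ.+ Σₛ ℤ.- + tri k
    ≡⟨ cong (λ m → + m ℤ.- H ℤ.+ Σₛ ℤ.- + tri k) (exponent-shift-ℕ {n} {h} {s} {k} s+k≤h h≤n) ⟩
  exponentM-base n h c s ℤ.- + tri k ∎
  where
  A = n ℕ.* (h ∸ (s + k))
  B = ((s + k ∸ s) ℕ.* (2 ℕ.* n ∸ (s + k) + s + 1)) ℕ./ 2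
  H = + (h ℕ.* h)
  Σₛ = (+ s) ℤ.* ((+ (2 ℕ.* n) ℤ.- + (2 ℕ.* c)) ℤ.- + s)
  regroup : ∀ W H Σₛ T → W ℤ.- H ℤ.+ Σₛ ≡ (W ℤ.+ T) ℤ.- H ℤ.+ Σₛ ℤ.- T
  regroup = ℤ.solve-∀

suc[[s+c]⊓h]∸s≡suc[c⊓[h∸s]] : ∀ {s c h} → s ≤ h → suc ((s + c) ⊓ h) ∸ s ≡ suc (c ⊓ (h ∸ s))
suc[[s+c]⊓h]∸s≡suc[c⊓[h∸s]] {s} {c} {h} s≤h = begin
  suc ((s + c) ⊓ h) ∸ s              ≡⟨ cong (λ z → suc ((s + c) ⊓ z) ∸ s) (ℕ.m+[n∸m]≡n s≤h) ⟨
  suc ((s + c) ⊓ (s + (h ∸ s))) ∸ s  ≡⟨ cong (λ z → suc z ∸ s) (ℕ.+-distribˡ-⊓ s c (h ∸ s)) ⟨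
  suc (s + c ⊓ (h ∸ s)) ∸ s          ≡⟨ cong (_∸ s) (ℕ.+-suc s (c ⊓ (h ∸ s))) ⟨
  s + suc (c ⊓ (h ∸ s)) ∸ s          ≡⟨ ℕ.m+n∸m≡n s (suc (c ⊓ (h ∸ s))) ⟩
  suc (c ⊓ (h ∸ s))                  ∎

c≤n∸s : ∀ {a b c n s} → s ≤ b → a + b + c ≡ n → c ≤ n ∸ s
c≤n∸s {a} {b} {c} {n} {s} s≤b a+b+c≡n = ℕ.m+n≤o⇒m≤o∸n c (subst (c + s ≤_) a+b+c≡n
  (ℕ.≤-trans (ℕ.+-monoʳ-≤ c s≤b)
  (ℕ.≤-trans (ℕ.≤-reflexive (ℕ.+-comm c b))
  (ℕ.≤-trans (ℕ.m≤n+m (b + c) a) (ℕ.≤-reflexive (sym (ℕ.+-assoc a b c)))))))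

n∸s<[h∸s]+c : ∀ {n h c s} → s ≤ h → h ≤ n → n ∸ h < c → n ∸ s < h ∸ s + c
n∸s<[h∸s]+c {n} {h} {c} {s} s≤h h≤n n∸h<c = subst (_< h ∸ s + c) (sym n∸s≡[h∸s]+[n∸h]) (ℕ.+-monoʳ-< (h ∸ s) n∸h<c)
  where
  n∸s≡[h∸s]+[n∸h] : n ∸ s ≡ h ∸ s + (n ∸ h)
  n∸s≡[h∸s]+[n∸h] = trans (cong (_∸ s) (sym (ℕ.m+[n∸m]≡n h≤n))) (ℕ.+-∸-comm (n ∸ h) s≤h)

-- Specialisation to x = -q

z/1≡fromℤ : ∀ z → z ℚ./ 1 ≡ fromℤ z
z/1≡fromℤ (+ n)    = ℚ.normalize-coprime (Coprime.sym (Coprime.1-coprimeTo n))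
z/1≡fromℤ -[1+ n ] = cong -_ (ℚ.normalize-coprime (Coprime.sym (Coprime.1-coprimeTo (suc n))))

fromℤ-injective : ∀ {i j} → fromℤ i ≡ fromℤ j → i ≡ j
fromℤ-injective = cong ℚ.↥_

powN-fromℤ : ∀ z l → powN (fromℤ z) l ≡ fromℤ (z ℤ.^ l)
powN-fromℤ z zero    = refl
powN-fromℤ z (suc l) = trans (cong (fromℤ z *_) (powN-fromℤ z l)) (z/1≡fromℤ (z ℤ.* z ℤ.^ l))

-q≡fromℤ : ∀ q → -mq q ≡ fromℤ (ℤ.- + q)
-q≡fromℤ zero    = refl
-q≡fromℤ (suc q) = cong -_ (z/1≡fromℤ (+ suc q))

-q≢0 : ∀ {q} → 2 ≤ q → -mq q ≢ 0ℚ
-q≢0 {suc (suc q)} _ -q≡0 with fromℤ-injective (trans (sym (-q≡fromℤ (suc (suc q)))) -q≡0)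
... | ()

-q^suc≢1 : ∀ {q} → 2 ≤ q → ∀ l → powN (-mq q) (suc l) ≢ 1ℚ
-q^suc≢1 {q} 2≤q l -q^suc≡1 = ℕ.<⇒≢ 2≤q (sym (ℕ.m*n≡1⇒m≡1 q ℤ.∣ -q ℤ.^ l ∣ q*∣-q^l∣≡1))
  where
  -q = ℤ.- + q
  -q^suc≡1ℤ : -q ℤ.* -q ℤ.^ l ≡ + 1
  -q^suc≡1ℤ = fromℤ-injective (begin
    fromℤ (-q ℤ.^ suc l)      ≡⟨ powN-fromℤ -q (suc l) ⟨
    powN (fromℤ -q) (suc l)   ≡⟨ cong (λ y → powN y (suc l)) (-q≡fromℤ q) ⟨
    powN (-mq q) (suc l)      ≡⟨ -q^suc≡1 ⟩
    1ℚ                        ∎)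
  q*∣-q^l∣≡1 : q ℕ.* ℤ.∣ -q ℤ.^ l ∣ ≡ 1
  q*∣-q^l∣≡1 = begin
    q ℕ.* ℤ.∣ -q ℤ.^ l ∣             ≡⟨ cong (ℕ._* ℤ.∣ -q ℤ.^ l ∣) (ℤ.∣-i∣≡∣i∣ (+ q)) ⟨
    ℤ.∣ -q ∣ ℕ.* ℤ.∣ -q ℤ.^ l ∣      ≡⟨ ℤ.abs-* -q (-q ℤ.^ l) ⟨
    ℤ.∣ -q ℤ.* -q ℤ.^ l ∣            ≡⟨ cong ℤ.∣_∣ -q^suc≡1ℤ ⟩
    1                                ∎

oddPrimePower⇒2≤ : ∀ {q} → OddPrimePower q → 2 ≤ q
oddPrimePower⇒2≤ (zero , _ , p-prime , _)                          = ⊥-elim (¬prime[0] p-prime)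
oddPrimePower⇒2≤ (suc zero , _ , p-prime , _)                      = ⊥-elim (¬prime[1] p-prime)
oddPrimePower⇒2≤ (p@(suc (suc _)) , suc k , _ , _ , _ , refl) =
  ℕ.*-mono-≤ {2} {p} {1} (s≤s (s≤s z≤n)) (ℕ.m^n>0 p k)

module _ {q : ℕ} (2≤q : 2 ≤ q) where

  open QAnalysis (-mq q) (-q≢0 2≤q) (-q^suc≢1 2≤q)

  M-prefactor : ℕ → ℕ → ℕ → ℕ → ℕ → ℕ → ℚ
  M-prefactor n h a b c s =
    powZ (-mq q) (exponentM-base n h c s) * powN (- 1ℚ) (s + h) * inv (P q (n ∸ h)) * inv (P q h)
    * prodFromTo (suc s) h (λ l → 1ℚ - powZ (-mq q) (ℤ.- (+ l))) * (P q c * P q b) * inv (P q (b ∸ s))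
    * 𝒞 q (+ (h + 1 ∸ s)) a (b ∸ s) c

  -- For a ≠ 0, 𝒞 ignores its third argument c + s - i, so the only i-dependence of M is the weight.
  M≡M-prefactor*weight : ∀ {n h a b c s k} → s + k ≤ h → h ≤ n →
    M q n h (suc a) b c (s + k) s ≡ M-prefactor n h (suc a) b c s * weight (n ∸ s) (h ∸ s) c k
  M≡M-prefactor*weight {n} {h} {a} {b} {c} {s} {k} s+k≤h h≤n = begin
    M q n h (suc a) b c (s + k) s
      ≡⟨ cong₂ _*_ (cong₂ _*_ (cong₂ _*_ (cong₂ _*_ (cong₂ _*_ power sign)
           (cong (λ i → P q i ÷ (P q (n ∸ h) * P q h)) (sym (ℕ.∸-+-assoc n s k))))
           (cong₂ (λ i j → R ÷ (P q i * P q j)) (sym (ℕ.∸-+-assoc h s k)) (ℕ.m+n∸m≡n s k)))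
           (cong (λ i → (P q c * P q b) ÷ (P q i * P q (b ∸ s))) c+s∸[s+k]≡c∸k)) refl ⟩
    (E * inv (powN (-mq q) (tri k))) * (powN (- 1ℚ) (s + h) * powN (- 1ℚ) k)
      * (P q (n ∸ s ∸ k) ÷ (P q (n ∸ h) * P q h)) * (R ÷ (P q (h ∸ s ∸ k) * P q k))
      * ((P q c * P q b) ÷ (P q (c ∸ k) * P q (b ∸ s))) * C
      ≡⟨ regroup E (inv (powN (-mq q) (tri k))) (powN (- 1ℚ) (s + h)) (powN (- 1ℚ) k) (P q (n ∸ s ∸ k))
                 (P q (n ∸ h)) (P q h) R (P q (h ∸ s ∸ k)) (P q k) (P q c) (P q b) (P q (c ∸ k)) (P q (b ∸ s)) C ⟩
    M-prefactor n h (suc a) b c s * weight (n ∸ s) (h ∸ s) c k ∎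
    where
    E = powZ (-mq q) (exponentM-base n h c s)
    R = prodFromTo (suc s) h (λ l → 1ℚ - powZ (-mq q) (ℤ.- (+ l)))
    C = 𝒞 q (+ (h + 1 ∸ s)) (suc a) (b ∸ s) c
    power : powZ (-mq q) (exponentM n h c (s + k) s) ≡ E * inv (powN (-mq q) (tri k))
    power = trans (cong (powZ (-mq q)) (exponentM-shift {n} {h} {c} {s} {k} s+k≤h h≤n))
                  (trans (powZ-+ (-q≢0 2≤q) (exponentM-base n h c s) (ℤ.- + tri k))
                         (cong (E *_) (powZ-neg (-mq q) (tri k))))
    sign : powN (- 1ℚ) (s + k + h) ≡ powN (- 1ℚ) (s + h) * powN (- 1ℚ) k
    sign = trans (cong (powN (- 1ℚ)) (swap s k h)) (powN-distribˡ-+-* (- 1ℚ) (s + h) k)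
      where
      swap : ∀ s k h → s + k + h ≡ s + h + k
      swap = solve-∀
    c+s∸[s+k]≡c∸k : c + s ∸ (s + k) ≡ c ∸ k
    c+s∸[s+k]≡c∸k = trans (cong (_∸ (s + k)) (ℕ.+-comm c s)) (ℕ.[m+n]∸[m+o]≡n∸o s c k)
    regroup : ∀ e τ σ σₖ pNk pnh ph r pmk pk pc pb pck pbs γ →
      (e * τ) * (σ * σₖ) * (pNk ÷ (pnh * ph)) * (r ÷ (pmk * pk)) * ((pc * pb) ÷ (pck * pbs)) * γ
      ≡ (e * σ * inv pnh * inv ph * r * (pc * pb) * inv pbs * γ) * (σₖ * τ * pNk * inv pmk * inv pk * inv pck)
    regroup e τ σ σₖ pNk pnh ph r pmk pk pc pb pck pbs γ
      rewrite inv-distrib-* pnh ph | inv-distrib-* pmk pk | inv-distrib-* pck pbs =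
      solve 15 (λ e τ σ σₖ pNk inh ih r imk ik pc pb ick ibs γ →
        (e :* τ) :* (σ :* σₖ) :* (pNk :* (inh :* ih)) :* (r :* (imk :* ik)) :* ((pc :* pb) :* (ick :* ibs)) :* γ
        := (e :* σ :* inh :* ih :* r :* (pc :* pb) :* ibs :* γ) :* (σₖ :* τ :* pNk :* imk :* ik :* ick)) refl
        e τ σ σₖ pNk (inv pnh) (inv ph) r (inv pmk) (inv pk) pc pb (inv pck) (inv pbs) γ

  innerSum≡0 : ∀ {n h a b c s} → s ≤ h → s ≤ b → h ≤ n → suc a + b + c ≡ n → n ∸ h < c →
    sumFromTo s ((s + c) ⊓ h) (λ i → M q n h (suc a) b c i s) ≡ 0ℚ
  innerSum≡0 {n} {h} {a} {b} {c} {s} s≤h s≤b h≤n a+b+c≡n n∸h<c = begin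
    sumFromTo s ((s + c) ⊓ h) (λ i → M q n h (suc a) b c i s)
      ≡⟨ sumFromTo≡∑ s ((s + c) ⊓ h) (λ i → M q n h (suc a) b c i s) ⟩
    ∑[ k < suc ((s + c) ⊓ h) ∸ s ] M q n h (suc a) b c (s + k) s
      ≡⟨ cong (λ l → ∑[ k < l ] M q n h (suc a) b c (s + k) s) (suc[[s+c]⊓h]∸s≡suc[c⊓[h∸s]] s≤h) ⟩
    ∑[ k < suc (c ⊓ m) ] M q n h (suc a) b c (s + k) s
      ≡⟨ ∑-cong (suc (c ⊓ m)) {g = λ k → K * weight N m c k}
           (λ k k<l → M≡M-prefactor*weight {n} {h} {a} {b} {c} {s} {k} (s+k≤h (ℕ.≤-pred k<l)) h≤n) ⟩
    ∑[ k < suc (c ⊓ m) ] (K * weight N m c k)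
      ≡⟨ *-distribˡ-∑ (suc (c ⊓ m)) K (weight N m c) ⟨
    K * ∑< (suc (c ⊓ m)) (weight N m c)
      ≡⟨ cong (K *_) (∑-weight-up-to-min≡0 m≤N c≤N N<m+c) ⟩
    K * 0ℚ
      ≡⟨ ℚ.*-zeroʳ K ⟩
    0ℚ ∎
    where
    N = n ∸ s
    m = h ∸ s
    K = M-prefactor n h (suc a) b c s
    s+k≤h : ∀ {k} → k ≤ c ⊓ m → s + k ≤ h
    s+k≤h k≤c⊓m = subst (s + _ ≤_) (ℕ.m+[n∸m]≡n s≤h) (ℕ.+-monoʳ-≤ s (ℕ.≤-trans k≤c⊓m (ℕ.m⊓n≤n c m)))
    m≤N : m ≤ N
    m≤N = ℕ.∸-monoˡ-≤ s h≤n
    c≤N : c ≤ N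
    c≤N = c≤n∸s {suc a} s≤b a+b+c≡n
    N<m+c : N < m + c
    N<m+c = n∸s<[h∸s]+c s≤h h≤n n∸h<c

  D≡0 : ∀ {n h a b c} → h ≤ n → suc a + b + c ≡ n → n ∸ h < c → D q n h (suc a) b c ≡ 0ℚ
  D≡0 {n} {h} {a} {b} {c} h≤n a+b+c≡n n∸h<c = begin
    D q n h (suc a) b c
      ≡⟨ sumFromTo≡∑ 0 (h ⊓ b) inner ⟩
    ∑< (suc (h ⊓ b)) inner
      ≡⟨ ∑-cong (suc (h ⊓ b)) (λ s s<1+h⊓b → let s≤h⊓b = ℕ.≤-pred s<1+h⊓b in
           innerSum≡0 (ℕ.≤-trans s≤h⊓b (ℕ.m⊓n≤m h b)) (ℕ.≤-trans s≤h⊓b (ℕ.m⊓n≤n h b)) h≤n a+b+c≡n n∸h<c) ⟩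
    ∑[ s < suc (h ⊓ b) ] 0ℚ
      ≡⟨ ∑-0 (suc (h ⊓ b)) ⟩
    0ℚ ∎
    where
    inner : ℕ → ℚ
    inner s = sumFromTo s ((s + c) ⊓ h) (λ i → M q n h (suc a) b c i s)

lemma9p5 : (q : ℕ) → OddPrimePower q →
    (n a b c h : ℕ) → a ≤ n → b ≤ n → c ≤ n → h ≤ n → a + b + c ≡ n →
    n ∸ h < c → a ≢ 0 →
    D q n h a b c ≡ 0ℚ
lemma9p5 q _            n zero    b c h _ _ _ _   _        _     a≢0 = ⊥-elim (a≢0 refl)
lemma9p5 q q-primePower n (suc a) b c h _ _ _ h≤n a+b+c≡n n∸h<c _   =
  D≡0 (oddPrimePower⇒2≤ q-primePower) h≤n a+b+c≡n n∸h<c
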